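{- As formal power series in $y$, \[ \sum_{n\ge 0}D_n(x)y^n = -y+xy+x^2y^2+\frac{1+y -x^2y^2} {(1-xy)(1-xy^2)-xy^3}. \]
   Context: For $n\ge 0$, the $S$-fence $\phi_n$ is the poset on $\{x_1,\dots,x_n\}$ whose order is generated by the cover relations $x_2<x_1$, $x_3<x_2$, $x_2<x_4$, $x_5<x_4$, and, for every $i\ge 3$, $x_{2i-1}<x_{2i}$ and $x_{2i+1}<x_{2i}$, keeping only those relations whose elements both have index $\le n$ ($\phi_0$ is empty and $\Phi_0$ is a single vertex). A filter is an up-set. $\Phi_n$ is the underlying undirected graph of the Hasse diagram of the lattice of filters of $\phi_n$ ordered by reverse inclusion (two filters adjacent iff they differ in exactly one element). $d_{n,k}$ is the number of vertices of $\Phi_n$ of degree $k$, and $D_n(x)=\sum_{k\ge0}d_{n,k}x^k$. -}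

module Defs where

open import Data.Bool using (Bool; true; false; _∧_; _∨_; not; if_then_else_)
open import Data.Nat using (ℕ; zero; suc; _∸_; _≡ᵇ_; _≤ᵇ_; _*_)
open import Data.List using (List; []; _∷_; map; length; filterᵇ; upTo; foldr; _++_; zipWith)
open import Data.Integer as ℤ using (ℤ; +_; -_)

-- The S-fence φ_n on {x_1,…,x_n}.  Element x_a is identified with the
-- natural number a (1 ≤ a ≤ n).

even : ℕ → Bool
even zero          = true
even (suc zero)    = false
even (suc (suc m)) = even m

-- cover a b = true  iff  "x_a < x_b" is one of the generating cover
-- relations: x2<x1, x3<x2, x2<x4, x5<x4, and for every i ≥ 3
-- x_{2i-1} < x_{2i} and x_{2i+1} < x_{2i}  (i.e. b = 2i even, b ≥ 6,
-- a = b-1 or a = b+1).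
cover : ℕ → ℕ → Bool
cover a b =
     ((a ≡ᵇ 2) ∧ (b ≡ᵇ 1))
  ∨ ((a ≡ᵇ 3) ∧ (b ≡ᵇ 2))
  ∨ ((a ≡ᵇ 2) ∧ (b ≡ᵇ 4))
  ∨ ((a ≡ᵇ 5) ∧ (b ≡ᵇ 4))
  ∨ (even b ∧ (6 ≤ᵇ b) ∧ ((a ≡ᵇ (b ∸ 1)) ∨ (a ≡ᵇ suc b)))

-- A subset of {x_1,…,x_n} is a list of n booleans; the (a)-th entry
-- (1-based) says whether x_a belongs to it.
Subset : Set
Subset = List Bool

-- membership of x_a (1-based index; false out of range)
mem : Subset → ℕ → Bool
mem []       _             = false
mem (b ∷ bs) zero          = false
mem (b ∷ bs) (suc zero)    = b
mem (b ∷ bs) (suc (suc a)) = mem bs (suc a)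

subsets : ℕ → List Subset
subsets zero    = [] ∷ []
subsets (suc n) = map (true ∷_) (subsets n) ++ map (false ∷_) (subsets n)

allᵇ : {A : Set} → (A → Bool) → List A → Bool
allᵇ p []       = true
allᵇ p (a ∷ as) = p a ∧ allᵇ p as

indices : ℕ → List ℕ
indices n = map suc (upTo n)

-- Since the order of φ_n is generated by the
-- cover relations (reflexive–transitive closure), a subset is an up-set
-- iff it is closed upward along every generating cover relation among
-- elements of index ≤ n.
isFilter : ℕ → Subset → Bool
isFilter n S =
  allᵇ (λ a → allᵇ (λ b → not (cover a b ∧ mem S a) ∨ mem S b) (indices n)) (indices n)

-- The vertices of Φ_n: the filters of φ_n.
filters : ℕ → List Subset
filters n = filterᵇ (isFilter n) (subsets n)

hamming : Subset → Subset → ℕ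
hamming []       _        = 0
hamming (_ ∷ _)  []       = 0
hamming (a ∷ as) (b ∷ bs) = (if (a ∧ not b) ∨ (b ∧ not a) then 1 else 0) Data.Nat.+ hamming as bs

adjacent : Subset → Subset → Bool
adjacent S T = hamming S T ≡ᵇ 1

degree : ℕ → Subset → ℕ
degree n S = length (filterᵇ (adjacent S) (filters n))

d : ℕ → ℕ → ℕ
d n k = length (filterᵇ (λ S → degree n S ≡ᵇ k) (filters n))

-- Formal power series in y with coefficients formal power series
-- (in particular polynomials) in x, over ℤ:
-- f n k = coefficient of x^k y^n.

Series : Set
Series = ℕ → ℕ → ℤ

sumTo : ℕ → (ℕ → ℤ) → ℤ
sumTo n f = foldr ℤ._+_ (+ 0) (map f (upTo (suc n)))

_⊕_ : Series → Series → Series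
(f ⊕ g) n k = f n k ℤ.+ g n k

⊝_ : Series → Series
(⊝ f) n k = - f n k

_⊗_ : Series → Series → Series
(f ⊗ g) n k = sumTo n (λ i → sumTo k (λ j → f i j ℤ.* g (n ∸ i) (k ∸ j)))

mono : ℕ → ℕ → Series
mono a b n k = if (n ≡ᵇ b) ∧ (k ≡ᵇ a) then + 1 else + 0

one x y : Series
one = mono 0 0
x   = mono 1 0
y   = mono 0 1

genD : Series
genD n k = + d n k

numer : Series
numer = (one ⊕ y) ⊕ (⊝ (mono 2 2))

denom : Series
denom = ((one ⊕ (⊝ mono 1 1)) ⊗ (one ⊕ (⊝ mono 1 2))) ⊕ (⊝ mono 1 3)

-- For n ≥ 4 the element x_{n+1} of the fence is comparable only with x_n, so the filters of
-- φ_{n+1} are the filters S of φ_n, with or without x_{n+1}, subject to one condition linking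
-- x_n and x_{n+1} that depends only on the parity of n. Describe a filter S of φ_n by its state:
-- whether x_n ∈ S, and how many neighbours of S in Φ_n agree, resp. disagree, with S at x_n
-- (together they make up the degree of S). The state of an extension of S depends only on the
-- state of S, so a sum over the filters of any function of the state is transformed by an explicit
-- transfer operator. Three steps of it and a finite check over the states give
--   d_{n,k} + d_{n-3,k-2} = d_{n-1,k-1} + d_{n-2,k-1} + d_{n-3,k-1}   for n ≥ 7,
-- i.e. the product of the left-hand side with the denominator has no term in y^n for n ≥ 7;
-- its coefficients for n ≤ 6 are computed.

module Submission where

open import Algebra.Properties.CommutativeSemigroup using (interchange; x∙yz≈y∙xz)
open import Data.Bool using (Bool; true; false; _∧_; _∨_; not; if_then_else_)
open import Data.Bool.Properties using (∧-assoc; ∧-zeroʳ; ∧-identityʳ; ∨-zeroʳ)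
open import Data.List using (List; []; _∷_; map; length; filterᵇ; _++_; _∷ʳ_; upTo)
open import Data.List.Properties using (map-++; map-∘; map-cong; upTo-∷ʳ)
open import Data.Nat using (ℕ; zero; suc)
open import Function using (_∘_; id)
open import Relation.Binary.PropositionalEquality
open import Defs

module DegreeRecurrence where

  open import Data.Nat using (_+_; _∸_; _≡ᵇ_; _<ᵇ_; _≤ᵇ_; _<_; s≤s)
  open import Data.Nat.ListAction using (sum)
  open import Data.Nat.ListAction.Properties using (sum-++)
  open import Data.Nat.Properties
    using (+-assoc; +-comm; +-identityʳ; +-commutativeSemigroup; suc-injective; ≤-refl; ≤-trans; n≤1+n;
           m∸n≤m)
  open import Data.Nat.Tactic.RingSolver using (solve-∀)

  iverson : Bool → ℕ
  iverson b = if b then 1 else 0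

  sum-map-++ : ∀ {A : Set} (f : A → ℕ) xs ys →
    sum (map f (xs ++ ys)) ≡ sum (map f xs) + sum (map f ys)
  sum-map-++ f xs ys = trans (cong sum (map-++ f xs ys)) (sum-++ (map f xs) (map f ys))

  sum-map-+ : ∀ {A : Set} (f g : A → ℕ) xs →
    sum (map (λ x → f x + g x) xs) ≡ sum (map f xs) + sum (map g xs)
  sum-map-+ f g []       = refl
  sum-map-+ f g (x ∷ xs) =
    trans (cong (f x + g x +_) (sum-map-+ f g xs)) (interchange +-commutativeSemigroup (f x) (g x) _ _)

  sum-map-cong : ∀ {A : Set} {f g : A → ℕ} xs → (∀ x → f x ≡ g x) → sum (map f xs) ≡ sum (map g xs)
  sum-map-cong xs f≡g = cong sum (map-cong f≡g xs)

  sum-map-zero : ∀ {A : Set} (f : A → ℕ) xs → (∀ x → f x ≡ 0) → sum (map f xs) ≡ 0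
  sum-map-zero f []       f≡0 = refl
  sum-map-zero f (x ∷ xs) f≡0 = cong₂ _+_ (f≡0 x) (sum-map-zero f xs f≡0)

  sum-map-if : ∀ {A : Set} b (f : A → ℕ) xs →
    sum (map (λ x → if b then f x else 0) xs) ≡ (if b then sum (map f xs) else 0)
  sum-map-if true  f xs = refl
  sum-map-if false f xs = sum-map-zero _ xs (λ _ → refl)

  sum-map-filterᵇ : ∀ {A : Set} (p : A → Bool) (f : A → ℕ) xs →
    sum (map f (filterᵇ p xs)) ≡ sum (map (λ x → if p x then f x else 0) xs)
  sum-map-filterᵇ p f []       = refl
  sum-map-filterᵇ p f (x ∷ xs) with p x
  ... | true  = cong (f x +_) (sum-map-filterᵇ p f xs)
  ... | false = sum-map-filterᵇ p f xs

  length-filterᵇ : ∀ {A : Set} (p : A → Bool) xs → length (filterᵇ p xs) ≡ sum (map (iverson ∘ p) xs)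
  length-filterᵇ p []       = refl
  length-filterᵇ p (x ∷ xs) with p x
  ... | true  = cong suc (length-filterᵇ p xs)
  ... | false = length-filterᵇ p xs

  sum-subsets-suc : ∀ n (f : Subset → ℕ) →
    sum (map f (subsets (suc n)))
      ≡ sum (map (f ∘ (true ∷_)) (subsets n)) + sum (map (f ∘ (false ∷_)) (subsets n))
  sum-subsets-suc n f = trans (sum-map-++ f (map (true ∷_) (subsets n)) _)
    (cong₂ _+_ (cong sum (sym (map-∘ (subsets n)))) (cong sum (sym (map-∘ (subsets n)))))

  sum-subsets-∷ʳ : ∀ n (f : Subset → ℕ) →
    sum (map f (subsets (suc n))) ≡ sum (map (λ S → f (S ∷ʳ true) + f (S ∷ʳ false)) (subsets n))
  sum-subsets-∷ʳ zero    f = sym (+-assoc (f (true ∷ [])) (f (false ∷ [])) 0)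
  sum-subsets-∷ʳ (suc n) f = begin
    sum (map f (subsets (suc (suc n))))
      ≡⟨ sum-subsets-suc (suc n) f ⟩
    sum (map (f ∘ (true ∷_)) (subsets (suc n))) + sum (map (f ∘ (false ∷_)) (subsets (suc n)))
      ≡⟨ cong₂ _+_ (sum-subsets-∷ʳ n (f ∘ (true ∷_))) (sum-subsets-∷ʳ n (f ∘ (false ∷_))) ⟩
    sum (map (λ S → f (true ∷ S ∷ʳ true) + f (true ∷ S ∷ʳ false)) (subsets n))
      + sum (map (λ S → f (false ∷ S ∷ʳ true) + f (false ∷ S ∷ʳ false)) (subsets n))
      ≡⟨ sum-subsets-suc n (λ S → f (S ∷ʳ true) + f (S ∷ʳ false)) ⟨
    sum (map (λ S → f (S ∷ʳ true) + f (S ∷ʳ false)) (subsets (suc n)))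
      ∎
    where open ≡-Reasoning

  sum-subsets-cong : ∀ n {f g : Subset → ℕ} → (∀ S → length S ≡ n → f S ≡ g S) →
    sum (map f (subsets n)) ≡ sum (map g (subsets n))
  sum-subsets-cong zero    f≡g = cong (_+ 0) (f≡g [] refl)
  sum-subsets-cong (suc n) {f} {g} f≡g = begin
    sum (map f (subsets (suc n)))
      ≡⟨ sum-subsets-suc n f ⟩
    sum (map (f ∘ (true ∷_)) (subsets n)) + sum (map (f ∘ (false ∷_)) (subsets n))
      ≡⟨ cong₂ _+_ (sum-subsets-cong n (λ S eq → f≡g (true ∷ S) (cong suc eq)))
                   (sum-subsets-cong n (λ S eq → f≡g (false ∷ S) (cong suc eq))) ⟩
    sum (map (g ∘ (true ∷_)) (subsets n)) + sum (map (g ∘ (false ∷_)) (subsets n))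
      ≡⟨ sum-subsets-suc n g ⟨
    sum (map g (subsets (suc n)))
      ∎
    where open ≡-Reasoning

  sum-subsets-hamming-zero : ∀ n S → length S ≡ n → (g : Subset → Bool → ℕ) → (∀ T → g T false ≡ 0) →
    sum (map (λ T → g T (hamming S T ≡ᵇ 0)) (subsets n)) ≡ g S true
  sum-subsets-hamming-zero zero [] _ g g≡0 = +-identityʳ (g [] true)
  sum-subsets-hamming-zero (suc n) (true ∷ S) eq g g≡0 = trans (sum-subsets-suc n _)
    (trans (cong₂ _+_ (sum-subsets-hamming-zero n S (suc-injective eq) (g ∘ (true ∷_)) (g≡0 ∘ (true ∷_)))
                      (sum-map-zero _ (subsets n) (g≡0 ∘ (false ∷_))))
           (+-identityʳ _))
  sum-subsets-hamming-zero (suc n) (false ∷ S) eq g g≡0 = trans (sum-subsets-suc n _)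
    (cong₂ _+_ (sum-map-zero _ (subsets n) (g≡0 ∘ (true ∷_)))
               (sum-subsets-hamming-zero n S (suc-injective eq) (g ∘ (false ∷_)) (g≡0 ∘ (false ∷_))))

  even-suc : ∀ n → even (suc n) ≡ not (even n)
  even-suc zero          = refl
  even-suc (suc zero)    = refl
  even-suc (suc (suc n)) = even-suc n

  ≡ᵇ-refl : ∀ n → (n ≡ᵇ n) ≡ true
  ≡ᵇ-refl zero    = refl
  ≡ᵇ-refl (suc n) = ≡ᵇ-refl n

  <⇒≡ᵇ-false : ∀ {a b} → a < b → (a ≡ᵇ b) ≡ false
  <⇒≡ᵇ-false {zero}  {suc b} _         = refl
  <⇒≡ᵇ-false {suc a} {suc b} (s≤s a<b) = <⇒≡ᵇ-false a<b

  >⇒≡ᵇ-false : ∀ {a b} → b < a → (a ≡ᵇ b) ≡ false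
  >⇒≡ᵇ-false {suc a} {zero}  _         = refl
  >⇒≡ᵇ-false {suc a} {suc b} (s≤s b<a) = >⇒≡ᵇ-false b<a

  cover-new-from-below : ∀ m a → a < 4 + m → cover a (5 + m) ≡ false
  cover-new-from-below m a a<n
    rewrite ∧-zeroʳ (a ≡ᵇ 2) | ∧-zeroʳ (a ≡ᵇ 3) | ∧-zeroʳ (a ≡ᵇ 5)
          | <⇒≡ᵇ-false a<n | <⇒≡ᵇ-false (≤-trans a<n (≤-trans (n≤1+n _) (n≤1+n _)))
          | ∧-zeroʳ (0 <ᵇ m) | ∧-zeroʳ (even (suc m)) = refl

  cover-below-from-new : ∀ m b → b < 4 + m → cover (5 + m) b ≡ false
  cover-below-from-new m b b<n
    rewrite >⇒≡ᵇ-false {5 + m} {b ∸ 1} (s≤s (≤-trans (m∸n≤m b 1) (≤-trans (n≤1+n b) b<n)))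
          | >⇒≡ᵇ-false {5 + m} {suc b} (s≤s b<n) | ∧-zeroʳ (6 ≤ᵇ b) | ∧-zeroʳ (even b) = not-x₅<x₄ m b<n
    where
    not-x₅<x₄ : ∀ m {b} → b < 4 + m → ((m ≡ᵇ 0) ∧ (b ≡ᵇ 4)) ∨ false ≡ false
    not-x₅<x₄ zero    b<4 rewrite <⇒≡ᵇ-false b<4 = refl
    not-x₅<x₄ (suc m) _   = refl

  cover-last-new : ∀ m → cover (4 + m) (5 + m) ≡ even (5 + m)
  cover-last-new m rewrite ∧-zeroʳ (m ≡ᵇ 1) | ≡ᵇ-refl m = parity-decides m
    where
    parity-decides : ∀ m → even (suc m) ∧ (0 <ᵇ m) ∧ true ≡ even (suc m)
    parity-decides zero    = refl
    parity-decides (suc m) = ∧-identityʳ (even m)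

  cover-new-last : ∀ m → cover (5 + m) (4 + m) ≡ even (4 + m)
  cover-new-last zero                = refl
  cover-new-last (suc zero)          = refl
  cover-new-last (suc (suc m))
    rewrite >⇒≡ᵇ-false {suc (suc m)} {m} (n≤1+n _) | ≡ᵇ-refl m = ∧-identityʳ (even m)

  mem-∷ʳ : ∀ S s a → a < length S → mem (S ∷ʳ s) (suc a) ≡ mem S (suc a)
  mem-∷ʳ (b ∷ S) s zero    _         = refl
  mem-∷ʳ (b ∷ S) s (suc a) (s≤s a<n) = mem-∷ʳ S s a a<n

  mem-∷ʳ-last : ∀ S s → mem (S ∷ʳ s) (suc (length S)) ≡ s
  mem-∷ʳ-last []      s = refl
  mem-∷ʳ-last (b ∷ S) s = mem-∷ʳ-last S s

  indices-suc : ∀ n → indices (suc n) ≡ indices n ++ suc n ∷ []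
  indices-suc n = trans (cong (map suc) (sym (upTo-∷ʳ n))) (map-++ suc (upTo n) (n ∷ []))

  allᵇ-++ : ∀ (p : ℕ → Bool) xs ys → allᵇ p (xs ++ ys) ≡ allᵇ p xs ∧ allᵇ p ys
  allᵇ-++ p []       ys = refl
  allᵇ-++ p (x ∷ xs) ys = trans (cong (p x ∧_) (allᵇ-++ p xs ys)) (sym (∧-assoc (p x) _ _))

  allᵇ-indices-suc : ∀ (p : ℕ → Bool) n → allᵇ p (indices (suc n)) ≡ allᵇ p (indices n) ∧ p (suc n)
  allᵇ-indices-suc p n = trans (cong (allᵇ p) (indices-suc n))
    (trans (allᵇ-++ p (indices n) _) (cong (allᵇ p (indices n) ∧_) (∧-identityʳ (p (suc n)))))

  allᵇ-cong : ∀ {p q : ℕ → Bool} xs → (∀ a → p a ≡ q a) → allᵇ p xs ≡ allᵇ q xs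
  allᵇ-cong []       p≡q = refl
  allᵇ-cong (x ∷ xs) p≡q = cong₂ _∧_ (p≡q x) (allᵇ-cong xs p≡q)

  allᵇ-cong-indices : ∀ n (p q : ℕ → Bool) → (∀ a → a < n → p (suc a) ≡ q (suc a)) →
    allᵇ p (indices n) ≡ allᵇ q (indices n)
  allᵇ-cong-indices zero    p q p≡q = refl
  allᵇ-cong-indices (suc n) p q p≡q = begin
    allᵇ p (indices (suc n))       ≡⟨ allᵇ-indices-suc p n ⟩
    allᵇ p (indices n) ∧ p (suc n) ≡⟨ cong₂ _∧_ (allᵇ-cong-indices n p q λ a a<n → p≡q a (≤-trans a<n (n≤1+n n)))
                                                (p≡q n ≤-refl) ⟩
    allᵇ q (indices n) ∧ q (suc n) ≡⟨ allᵇ-indices-suc q n ⟨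
    allᵇ q (indices (suc n))       ∎
    where open ≡-Reasoning

  allᵇ-true : ∀ (xs : List ℕ) → allᵇ (λ _ → true) xs ≡ true
  allᵇ-true []       = refl
  allᵇ-true (x ∷ xs) = allᵇ-true xs

  allᵇ-indices-last : ∀ (p : ℕ → Bool) n → (∀ a → a < n → p (suc a) ≡ true) →
    allᵇ p (indices (suc n)) ≡ p (suc n)
  allᵇ-indices-last p n p≡true = trans (allᵇ-indices-suc p n)
    (cong (_∧ p (suc n)) (trans (allᵇ-cong-indices n p (λ _ → true) p≡true) (allᵇ-true (indices n))))

  ∧-interchange : ∀ a b c d → (a ∧ b) ∧ (c ∧ d) ≡ (a ∧ c) ∧ (b ∧ d)
  ∧-interchange true  true  c d = refl
  ∧-interchange true  false c d = sym (∧-zeroʳ c)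
  ∧-interchange false b     c d = refl

  allᵇ-∧ : ∀ (p q : ℕ → Bool) xs → allᵇ (λ a → p a ∧ q a) xs ≡ allᵇ p xs ∧ allᵇ q xs
  allᵇ-∧ p q []       = refl
  allᵇ-∧ p q (x ∷ xs) = trans (cong ((p x ∧ q x) ∧_) (allᵇ-∧ p q xs)) (∧-interchange (p x) (q x) _ _)

  allᵇ²-indices-suc : ∀ (F : ℕ → ℕ → Bool) n →
    allᵇ (λ a → allᵇ (F a) (indices (suc n))) (indices (suc n))
      ≡ (allᵇ (λ a → allᵇ (F a) (indices n)) (indices n) ∧ allᵇ (λ a → F a (suc n)) (indices n))
        ∧ (allᵇ (F (suc n)) (indices n) ∧ F (suc n) (suc n))
  allᵇ²-indices-suc F n = trans (allᵇ-indices-suc _ n) (cong₂ _∧_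
    (trans (allᵇ-cong (indices n) (λ a → allᵇ-indices-suc (F a) n)) (allᵇ-∧ _ _ (indices n)))
    (allᵇ-indices-suc (F (suc n)) n))

  mem-∷ʳ-length : ∀ S s {n} → length S ≡ n → mem (S ∷ʳ s) (suc n) ≡ s
  mem-∷ʳ-length S s refl = mem-∷ʳ-last S s

  -- admissible (even n) q s: a filter of φ_n that contains x_n iff q stays a filter of φ_{n+1}
  -- when x_{n+1} is added iff s (x_{n+1} lies below x_n for n even and above it for n odd).
  admissible : Bool → Bool → Bool → Bool
  admissible true  q s = not s ∨ q
  admissible false q s = not q ∨ s

  admissible-even : ∀ n q s →
    (not (even (suc n) ∧ q) ∨ s) ∧ (not (even n ∧ s) ∨ q) ≡ admissible (even n) q s
  admissible-even n q s rewrite even-suc n with even n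
  ... | true  = refl
  ... | false = ∧-identityʳ (not q ∨ s)

  isFilter-∷ʳ : ∀ m S s → length S ≡ 4 + m →
    isFilter (5 + m) (S ∷ʳ s) ≡ isFilter (4 + m) S ∧ admissible (even (4 + m)) (mem S (4 + m)) s
  isFilter-∷ʳ m S s len = begin
    isFilter (5 + m) (S ∷ʳ s)
      ≡⟨ allᵇ²-indices-suc closed′ n ⟩
    (allᵇ (λ a → allᵇ (closed′ a) (indices n)) (indices n) ∧ allᵇ (λ a → closed′ a (suc n)) (indices n))
      ∧ (allᵇ (closed′ (suc n)) (indices n) ∧ closed′ (suc n) (suc n))
      ≡⟨ cong₂ _∧_ (cong₂ _∧_ old new-above)
                   (cong₂ _∧_ new-below (not-∧-∨ (cover (suc n) (suc n)) s′)) ⟩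
    (isFilter n S ∧ (not (even (suc n) ∧ q) ∨ s)) ∧ ((not (even n ∧ s) ∨ q) ∧ true)
      ≡⟨ cong ((isFilter n S ∧ (not (even (suc n) ∧ q) ∨ s)) ∧_) (∧-identityʳ _) ⟩
    (isFilter n S ∧ (not (even (suc n) ∧ q) ∨ s)) ∧ (not (even n ∧ s) ∨ q)
      ≡⟨ ∧-assoc (isFilter n S) _ _ ⟩
    isFilter n S ∧ ((not (even (suc n) ∧ q) ∨ s) ∧ (not (even n ∧ s) ∨ q))
      ≡⟨ cong (isFilter n S ∧_) (admissible-even n q s) ⟩
    isFilter n S ∧ admissible (even n) q s
      ∎
    where
    open ≡-Reasoning
    n : ℕ
    n = 4 + m
    q s′ : Bool
    q = mem S n
    s′ = mem (S ∷ʳ s) (suc n)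
    closed closed′ : ℕ → ℕ → Bool
    closed  a b = not (cover a b ∧ mem S a) ∨ mem S b
    closed′ a b = not (cover a b ∧ mem (S ∷ʳ s) a) ∨ mem (S ∷ʳ s) b
    old-mem : ∀ a → a < n → mem (S ∷ʳ s) (suc a) ≡ mem S (suc a)
    old-mem a a<n = mem-∷ʳ S s a (subst (a <_) (sym len) a<n)
    last-mem : mem (S ∷ʳ s) n ≡ q
    last-mem = old-mem (3 + m) ≤-refl
    new-mem : s′ ≡ s
    new-mem = mem-∷ʳ-length S s len
    not-∧-∨ : ∀ c x → not (c ∧ x) ∨ x ≡ true
    not-∧-∨ c true  = ∨-zeroʳ _
    not-∧-∨ c false rewrite ∧-zeroʳ c = refl
    old : allᵇ (λ a → allᵇ (closed′ a) (indices n)) (indices n) ≡ isFilter n S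
    old = allᵇ-cong-indices n (λ a → allᵇ (closed′ a) (indices n)) (λ a → allᵇ (closed a) (indices n))
          λ a a<n →
            allᵇ-cong-indices n (closed′ (suc a)) (closed (suc a)) λ b b<n →
              cong₂ (λ u v → not (cover (suc a) (suc b) ∧ u) ∨ v) (old-mem a a<n) (old-mem b b<n)
    new-above : allᵇ (λ a → closed′ a (suc n)) (indices n) ≡ not (even (suc n) ∧ q) ∨ s
    new-above = trans
      (allᵇ-indices-last (λ a → closed′ a (suc n)) (3 + m) λ a a<n →
         cong (λ c → not (c ∧ mem (S ∷ʳ s) (suc a)) ∨ s′) (cover-new-from-below m (suc a) (s≤s a<n)))
      (cong₂ (λ u v → not u ∨ v) (cong₂ _∧_ (cover-last-new m) last-mem) new-mem)
    new-below : allᵇ (closed′ (suc n)) (indices n) ≡ not (even n ∧ s) ∨ q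
    new-below = trans
      (allᵇ-indices-last (closed′ (suc n)) (3 + m) λ b b<n →
         cong (λ c → not (c ∧ s′) ∨ mem (S ∷ʳ s) (suc b)) (cover-below-from-new m (suc b) (s≤s b<n)))
      (cong₂ (λ u v → not u ∨ v) (cong₂ _∧_ (cover-new-last m) new-mem) last-mem)

  mismatch : Bool → Bool → ℕ
  mismatch a b = if (a ∧ not b) ∨ (b ∧ not a) then 1 else 0

  hamming-∷ʳ : ∀ S T s t → length S ≡ length T →
    hamming (S ∷ʳ s) (T ∷ʳ t) ≡ mismatch s t + hamming S T
  hamming-∷ʳ []      []      s t _  = refl
  hamming-∷ʳ (a ∷ S) (b ∷ T) s t eq = trans
    (cong (mismatch a b +_) (hamming-∷ʳ S T s t (suc-injective eq)))
    (x∙yz≈y∙xz +-commutativeSemigroup (mismatch a b) (mismatch s t) (hamming S T))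

  sum-filters : ∀ n (f : Subset → ℕ) →
    sum (map f (filters n)) ≡ sum (map (λ S → if isFilter n S then f S else 0) (subsets n))
  sum-filters n f = sum-map-filterᵇ (isFilter n) f (subsets n)

  sum-filters-cong : ∀ n {f g : Subset → ℕ} → (∀ S → length S ≡ n → isFilter n S ≡ true → f S ≡ g S) →
    sum (map f (filters n)) ≡ sum (map g (filters n))
  sum-filters-cong n {f} {g} f≡g =
    trans (sum-filters n f) (trans (sum-subsets-cong n guarded) (sym (sum-filters n g)))
    where
    guarded : ∀ S → length S ≡ n → (if isFilter n S then f S else 0) ≡ (if isFilter n S then g S else 0)
    guarded S len with isFilter n S in isF
    ... | true  = f≡g S len isF
    ... | false = refl

  sumExtensions : ℕ → (Subset → ℕ) → Subset → ℕ
  sumExtensions n f S = extendBy true + extendBy false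
    where
    extendBy : Bool → ℕ
    extendBy s = if admissible (even n) (mem S n) s then f (S ∷ʳ s) else 0

  sum-filters-∷ʳ : ∀ m (f : Subset → ℕ) →
    sum (map f (filters (5 + m))) ≡ sum (map (sumExtensions (4 + m) f) (filters (4 + m)))
  sum-filters-∷ʳ m f = begin
    sum (map f (filters (5 + m)))
      ≡⟨ sum-filters (5 + m) f ⟩
    sum (map (λ S → if isFilter (5 + m) S then f S else 0) (subsets (5 + m)))
      ≡⟨ sum-subsets-∷ʳ (4 + m) _ ⟩
    sum (map (λ S → (if isFilter (5 + m) (S ∷ʳ true) then f (S ∷ʳ true) else 0)
                  + (if isFilter (5 + m) (S ∷ʳ false) then f (S ∷ʳ false) else 0)) (subsets (4 + m)))
      ≡⟨ sum-subsets-cong (4 + m) split ⟩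
    sum (map (λ S → if isFilter (4 + m) S then sumExtensions (4 + m) f S else 0) (subsets (4 + m)))
      ≡⟨ sum-filters (4 + m) _ ⟨
    sum (map (sumExtensions (4 + m) f) (filters (4 + m)))
      ∎
    where
    open ≡-Reasoning
    split : ∀ S → length S ≡ 4 + m →
      (if isFilter (5 + m) (S ∷ʳ true) then f (S ∷ʳ true) else 0)
        + (if isFilter (5 + m) (S ∷ʳ false) then f (S ∷ʳ false) else 0)
        ≡ (if isFilter (4 + m) S then sumExtensions (4 + m) f S else 0)
    split S len rewrite isFilter-∷ʳ m S true len | isFilter-∷ʳ m S false len with isFilter (4 + m) S
    ... | true  = refl
    ... | false = refl

  neighbours : ℕ → Subset → (Bool → Bool) → ℕ
  neighbours n S P = sum (map (λ T → if P (mem T n) then iverson (adjacent S T) else 0) (filters n))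

  if-swap : ∀ a p (x : ℕ) → (if a then (if p then x else 0) else 0) ≡ (if p then (if a then x else 0) else 0)
  if-swap true  p     x = refl
  if-swap false true  x = refl
  if-swap false false x = refl

  if-zero : ∀ b → (if b then 0 else 0) ≡ 0
  if-zero true  = refl
  if-zero false = refl

  extension-terms-by-new-bit : ∀ (a P : Bool → Bool) s h →
    (if a true then (if P true then iverson (mismatch s true + h ≡ᵇ 1) else 0) else 0)
      + (if a false then (if P false then iverson (mismatch s false + h ≡ᵇ 1) else 0) else 0)
    ≡ (if P s then (if a s then iverson (h ≡ᵇ 1) else 0) else 0)
      + (if P (not s) then (if a (not s) then iverson (h ≡ᵇ 0) else 0) else 0)
  extension-terms-by-new-bit a P true  h =
    cong₂ _+_ (if-swap (a true) (P true) _) (if-swap (a false) (P false) _)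
  extension-terms-by-new-bit a P false h =
    trans (+-comm (if a true then (if P true then iverson (h ≡ᵇ 0) else 0) else 0) _)
          (cong₂ _+_ (if-swap (a false) (P false) _) (if-swap (a true) (P true) _))

  neighbours-∷ʳ : ∀ m S s (P : Bool → Bool) → length S ≡ 4 + m → isFilter (4 + m) S ≡ true →
    neighbours (5 + m) (S ∷ʳ s) P
      ≡ (if P s then neighbours (4 + m) S (λ u → admissible (even (4 + m)) u s) else 0)
        + (if P (not s) then iverson (admissible (even (4 + m)) (mem S (4 + m)) (not s)) else 0)
  neighbours-∷ʳ m S s P len isF = begin
    neighbours (5 + m) (S ∷ʳ s) P
      ≡⟨ sum-filters-∷ʳ m counted ⟩
    sum (map (sumExtensions n counted) (filters n))
      ≡⟨ sum-filters-cong n (λ T lenT _ → by-new-bit T lenT) ⟩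
    sum (map (λ T → sameBit T + otherBit T) (filters n))
      ≡⟨ sum-map-+ sameBit otherBit (filters n) ⟩
    sum (map sameBit (filters n)) + sum (map otherBit (filters n))
      ≡⟨ cong₂ _+_ (sum-map-if (P s) _ (filters n))
                   (trans (sum-map-if (P (not s)) _ (filters n))
                          (cong (λ x → if P (not s) then x else 0) only-S)) ⟩
    (if P s then neighbours n S (λ u → admissible e u s) else 0)
      + (if P (not s) then iverson (admissible e (mem S n) (not s)) else 0)
      ∎
    where
    open ≡-Reasoning
    n : ℕ
    n = 4 + m
    e : Bool
    e = even n
    counted sameBit otherBit : Subset → ℕ
    counted T  = if P (mem T (5 + m)) then iverson (adjacent (S ∷ʳ s) T) else 0
    sameBit T  = if P s then (if admissible e (mem T n) s then iverson (hamming S T ≡ᵇ 1) else 0) else 0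
    otherBit T =
      if P (not s) then (if admissible e (mem T n) (not s) then iverson (hamming S T ≡ᵇ 0) else 0) else 0
    by-new-bit : ∀ T → length T ≡ n → sumExtensions n counted T ≡ sameBit T + otherBit T
    by-new-bit T lenT
      rewrite mem-∷ʳ-length T true lenT | mem-∷ʳ-length T false lenT
            | hamming-∷ʳ S T s true (trans len (sym lenT)) | hamming-∷ʳ S T s false (trans len (sym lenT))
      = extension-terms-by-new-bit (admissible e (mem T n)) P s (hamming S T)
    flipped : Subset → Bool → ℕ
    flipped T b = if isFilter n T then (if admissible e (mem T n) (not s) then iverson b else 0) else 0
    only-S : sum (map (λ T → if admissible e (mem T n) (not s) then iverson (hamming S T ≡ᵇ 0) else 0)
                      (filters n))
               ≡ iverson (admissible e (mem S n) (not s))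
    only-S = trans (sum-filters n _)
      (trans (sum-subsets-hamming-zero n S len flipped λ T →
                trans (cong (λ x → if isFilter n T then x else 0) (if-zero (admissible e (mem T n) (not s))))
                      (if-zero (isFilter n T)))
             (cong (λ b → if b then iverson (admissible e (mem S n) (not s)) else 0) isF))

  agreeing differing : ℕ → Subset → ℕ
  agreeing  n S = if mem S n then neighbours n S id  else neighbours n S not
  differing n S = if mem S n then neighbours n S not else neighbours n S id

  neighbours-split : ∀ n S (P : Bool → Bool) →
    neighbours n S P ≡ (if P true then neighbours n S id else 0) + (if P false then neighbours n S not else 0)
  neighbours-split n S P = trans
    (sum-map-cong (filters n) (λ T → by-bit (mem T n) (iverson (adjacent S T))))
    (trans (sum-map-+ _ _ (filters n))
           (cong₂ _+_ (sum-map-if (P true) _ (filters n)) (sum-map-if (P false) _ (filters n))))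
    where
    by-bit : ∀ u x → (if P u then x else 0)
                       ≡ (if P true then (if u then x else 0) else 0) + (if P false then (if not u then x else 0) else 0)
    by-bit true  x = sym (trans (cong ((if P true then x else 0) +_) (if-zero (P false))) (+-identityʳ _))
    by-bit false x = sym (cong (_+ (if P false then x else 0)) (if-zero (P true)))

  neighbours-by-side : ∀ n S (P : Bool → Bool) →
    neighbours n S P
      ≡ (if P (not (mem S n)) then differing n S else 0) + (if P (mem S n) then agreeing n S else 0)
  neighbours-by-side n S P = trans (neighbours-split n S P) (by-side (mem S n))
    where
    A B : ℕ
    A = neighbours n S id
    B = neighbours n S not
    by-side : ∀ q → (if P true then A else 0) + (if P false then B else 0)
                      ≡ (if P (not q) then (if q then B else A) else 0) + (if P q then (if q then A else B) else 0)
    by-side true  = +-comm (if P true then A else 0) _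
    by-side false = refl

  agreeing-∷ʳ-as-neighbours : ∀ m S s → length S ≡ 4 + m → isFilter (4 + m) S ≡ true →
    agreeing (5 + m) (S ∷ʳ s) ≡ neighbours (4 + m) S (λ u → admissible (even (4 + m)) u s)
  agreeing-∷ʳ-as-neighbours m S true len isF = trans
    (cong (λ u → if u then N id else N not) (mem-∷ʳ-length S true len))
    (trans (neighbours-∷ʳ m S true id len isF) (+-identityʳ _))
    where
    N : (Bool → Bool) → ℕ
    N = neighbours (5 + m) (S ∷ʳ true)
  agreeing-∷ʳ-as-neighbours m S false len isF = trans
    (cong (λ u → if u then N id else N not) (mem-∷ʳ-length S false len))
    (trans (neighbours-∷ʳ m S false not len isF) (+-identityʳ _))
    where
    N : (Bool → Bool) → ℕ
    N = neighbours (5 + m) (S ∷ʳ false)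

  agreeing-∷ʳ : ∀ m S s → length S ≡ 4 + m → isFilter (4 + m) S ≡ true →
    admissible (even (4 + m)) (mem S (4 + m)) s ≡ true →
    agreeing (5 + m) (S ∷ʳ s)
      ≡ (if admissible (even (4 + m)) (not (mem S (4 + m))) s then differing (4 + m) S else 0)
        + agreeing (4 + m) S
  agreeing-∷ʳ m S s len isF adm = trans (agreeing-∷ʳ-as-neighbours m S s len isF)
    (trans (neighbours-by-side n S (λ u → admissible e u s))
           (cong (λ b → D + (if b then agreeing n S else 0)) adm))
    where
    n : ℕ
    n = 4 + m
    e : Bool
    e = even n
    D : ℕ
    D = if admissible e (not (mem S n)) s then differing n S else 0

  differing-∷ʳ : ∀ m S s → length S ≡ 4 + m → isFilter (4 + m) S ≡ true →
    differing (5 + m) (S ∷ʳ s) ≡ iverson (admissible (even (4 + m)) (mem S (4 + m)) (not s))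
  differing-∷ʳ m S true len isF = trans
    (cong (λ u → if u then N not else N id) (mem-∷ʳ-length S true len))
    (neighbours-∷ʳ m S true not len isF)
    where
    N : (Bool → Bool) → ℕ
    N = neighbours (5 + m) (S ∷ʳ true)
  differing-∷ʳ m S false len isF = trans
    (cong (λ u → if u then N not else N id) (mem-∷ʳ-length S false len))
    (neighbours-∷ʳ m S false id len isF)
    where
    N : (Bool → Bool) → ℕ
    N = neighbours (5 + m) (S ∷ʳ false)

  Weight : Set
  Weight = Bool → ℕ → ℕ → ℕ

  stateSum : ℕ → Weight → ℕ
  stateSum n w = sum (map (λ S → w (mem S n) (agreeing n S) (differing n S)) (filters n))

  -- Appending s to a filter S in state (q, c, o) gives the state (s, c′, o′): the agreeing
  -- neighbours of S ∷ʳ s are the T ∷ʳ s with T a neighbour of S that admits s (all c agreeing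
  -- ones, and the o differing ones iff ¬q admits s), and its only differing one is S ∷ʳ ¬s.
  transfer : Bool → Weight → Weight
  transfer e w q c o = extendBy true + extendBy false
    where
    extendBy : Bool → ℕ
    extendBy s = if admissible e q s
                 then w s ((if admissible e (not q) s then o else 0) + c) (iverson (admissible e q (not s)))
                 else 0

  stateSum-∷ʳ : ∀ m w → stateSum (5 + m) w ≡ stateSum (4 + m) (transfer (even (4 + m)) w)
  stateSum-∷ʳ m w = trans (sum-filters-∷ʳ m _)
    (sum-filters-cong n (λ S len isF → cong₂ _+_ (extension S len isF true) (extension S len isF false)))
    where
    n : ℕ
    n = 4 + m
    e : Bool
    e = even n
    extension : ∀ S → length S ≡ n → isFilter n S ≡ true → ∀ s →
      (if admissible e (mem S n) s
       then w (mem (S ∷ʳ s) (suc n)) (agreeing (suc n) (S ∷ʳ s)) (differing (suc n) (S ∷ʳ s))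
       else 0)
        ≡ (if admissible e (mem S n) s
           then w s ((if admissible e (not (mem S n)) s then differing n S else 0) + agreeing n S)
                    (iverson (admissible e (mem S n) (not s)))
           else 0)
    extension S len isF s with admissible e (mem S n) s in adm
    ... | false = refl
    ... | true  = trans (cong (λ t → w t (agreeing (suc n) (S ∷ʳ s)) (differing (suc n) (S ∷ʳ s)))
                              (mem-∷ʳ-length S s len))
                        (cong₂ (w s) (agreeing-∷ʳ m S s len isF adm) (differing-∷ʳ m S s len isF))

  stateSum-+ : ∀ n (w w′ : Weight) →
    stateSum n (λ q c o → w q c o + w′ q c o) ≡ stateSum n w + stateSum n w′
  stateSum-+ n w w′ = sum-map-+ _ _ (filters n)

  stateSum-cong : ∀ n {w w′ : Weight} → (∀ q c o → w q c o ≡ w′ q c o) → stateSum n w ≡ stateSum n w′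
  stateSum-cong n w≡w′ = sum-map-cong (filters n) (λ S → w≡w′ _ _ _)

  stateSum-zero : ∀ n → stateSum n (λ _ _ _ → 0) ≡ 0
  stateSum-zero n = sum-map-zero _ (filters n) (λ _ → refl)

  degree≡differing+agreeing : ∀ n S → degree n S ≡ differing n S + agreeing n S
  degree≡differing+agreeing n S =
    trans (length-filterᵇ (adjacent S) (filters n)) (neighbours-by-side n S (λ _ → true))

  degreeWeight : (ℕ → ℕ) → Weight
  degreeWeight f q c o = f (o + c)

  stateSum-degreeWeight : ∀ n f → stateSum n (degreeWeight f) ≡ sum (map (f ∘ degree n) (filters n))
  stateSum-degreeWeight n f = sum-map-cong (filters n) (λ S → cong f (sym (degree≡differing+agreeing n S)))

  transfer³-identity : ∀ e f q c o →
    transfer e (transfer (not e) (transfer e (degreeWeight f))) q c o + degreeWeight (f ∘ suc ∘ suc) q c o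
      ≡ transfer e (transfer (not e) (degreeWeight (f ∘ suc))) q c o
        + transfer e (degreeWeight (f ∘ suc)) q c o + degreeWeight (f ∘ suc) q c o
  transfer³-identity true  f true  c o =
    even-in (f (2 + c)) (f (1 + (o + c))) (f (2 + (o + c))) (f (3 + (o + c)))
    where
    even-in : ∀ x y z t → x + x + 0 + (z + t + y) + z ≡ x + 0 + (t + z) + (x + z) + y
    even-in = solve-∀
  transfer³-identity true  f false c o = even-out (f (1 + (o + c))) (f (2 + (o + c)))
    where
    even-out : ∀ y z → y + z + y + z ≡ z + z + y + y
    even-out = solve-∀
  transfer³-identity false f true  c o = odd-in (f (1 + (o + c))) (f (2 + (o + c)))
    where
    odd-in : ∀ y z → y + 0 + (z + y) + 0 + z ≡ z + z + 0 + (y + 0) + y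
    odd-in = solve-∀
  transfer³-identity false f false c o =
    odd-out (f (2 + c)) (f (1 + (o + c))) (f (2 + (o + c))) (f (3 + (o + c)))
    where
    odd-out : ∀ x y z t → y + 0 + (t + z) + (x + x) + z ≡ z + t + x + (z + x) + y
    odd-out = solve-∀

  stateSum-recurrence : ∀ m f →
    stateSum (7 + m) (degreeWeight f) + stateSum (4 + m) (degreeWeight (f ∘ suc ∘ suc))
      ≡ stateSum (6 + m) (degreeWeight (f ∘ suc)) + stateSum (5 + m) (degreeWeight (f ∘ suc))
        + stateSum (4 + m) (degreeWeight (f ∘ suc))
  stateSum-recurrence m f = begin
    stateSum (7 + m) D₀ + stateSum n D₂
      ≡⟨ cong (_+ stateSum n D₂) (three-steps D₀) ⟩
    stateSum n (transfer e (transfer (not e) (transfer e D₀))) + stateSum n D₂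
      ≡⟨ stateSum-+ n (transfer e (transfer (not e) (transfer e D₀))) D₂ ⟨
    stateSum n (λ q c o → transfer e (transfer (not e) (transfer e D₀)) q c o + D₂ q c o)
      ≡⟨ stateSum-cong n (transfer³-identity e f) ⟩
    stateSum n (λ q c o → transfer e (transfer (not e) D₁) q c o + transfer e D₁ q c o + D₁ q c o)
      ≡⟨ stateSum-+ n (λ q c o → transfer e (transfer (not e) D₁) q c o + transfer e D₁ q c o) D₁ ⟩
    stateSum n (λ q c o → transfer e (transfer (not e) D₁) q c o + transfer e D₁ q c o) + stateSum n D₁
      ≡⟨ cong (_+ stateSum n D₁) (stateSum-+ n (transfer e (transfer (not e) D₁)) (transfer e D₁)) ⟩
    stateSum n (transfer e (transfer (not e) D₁)) + stateSum n (transfer e D₁) + stateSum n D₁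
      ≡⟨ cong₂ (λ x y → x + y + stateSum n D₁) (two-steps D₁) (stateSum-∷ʳ m D₁) ⟨
    stateSum (6 + m) D₁ + stateSum (5 + m) D₁ + stateSum n D₁
      ∎
    where
    open ≡-Reasoning
    n = 4 + m
    e = even n
    D₀ D₁ D₂ : Weight
    D₀ = degreeWeight f
    D₁ = degreeWeight (f ∘ suc)
    D₂ = degreeWeight (f ∘ suc ∘ suc)
    two-steps : ∀ w → stateSum (6 + m) w ≡ stateSum n (transfer e (transfer (not e) w))
    two-steps w = trans (stateSum-∷ʳ (1 + m) w) (trans (stateSum-∷ʳ m (transfer (even (5 + m)) w))
      (cong (λ e′ → stateSum n (transfer e (transfer e′ w))) (even-suc n)))
    three-steps : ∀ w → stateSum (7 + m) w ≡ stateSum n (transfer e (transfer (not e) (transfer e w)))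
    three-steps w = trans (stateSum-∷ʳ (2 + m) w) (two-steps (transfer e w))

  dShifted : ℕ → ℕ → ℕ → ℕ
  dShifted a n k = if a ≤ᵇ k then d n (k ∸ a) else 0

  ≤ᵇ-suc : ∀ a k → (suc a ≤ᵇ suc k) ≡ (a ≤ᵇ k)
  ≤ᵇ-suc zero    k = refl
  ≤ᵇ-suc (suc a) k = refl

  dShifted≡stateSum : ∀ a n k → dShifted a n k ≡ stateSum n (degreeWeight (λ j → iverson (a + j ≡ᵇ k)))
  dShifted≡stateSum zero    n k       = trans (length-filterᵇ (λ S → degree n S ≡ᵇ k) (filters n))
    (sym (stateSum-degreeWeight n (λ j → iverson (j ≡ᵇ k))))
  dShifted≡stateSum (suc a) n zero    = sym (stateSum-zero n)
  dShifted≡stateSum (suc a) n (suc k) =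
    trans (cong (λ b → if b then d n (k ∸ a) else 0) (≤ᵇ-suc a k)) (dShifted≡stateSum a n k)

  d-recurrence : ∀ m k →
    dShifted 0 (7 + m) k + dShifted 2 (4 + m) k
      ≡ dShifted 1 (6 + m) k + dShifted 1 (5 + m) k + dShifted 1 (4 + m) k
  d-recurrence m k = begin
    dShifted 0 (7 + m) k + dShifted 2 (4 + m) k
      ≡⟨ cong₂ _+_ (dShifted≡stateSum 0 (7 + m) k) (dShifted≡stateSum 2 (4 + m) k) ⟩
    stateSum (7 + m) (degreeWeight f) + stateSum (4 + m) (degreeWeight (f ∘ suc ∘ suc))
      ≡⟨ stateSum-recurrence m f ⟩
    stateSum (6 + m) (degreeWeight (f ∘ suc)) + stateSum (5 + m) (degreeWeight (f ∘ suc))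
      + stateSum (4 + m) (degreeWeight (f ∘ suc))
      ≡⟨ cong₂ _+_ (cong₂ _+_ (dShifted≡stateSum 1 (6 + m) k) (dShifted≡stateSum 1 (5 + m) k))
                   (dShifted≡stateSum 1 (4 + m) k) ⟨
    dShifted 1 (6 + m) k + dShifted 1 (5 + m) k + dShifted 1 (4 + m) k
      ∎
    where
    open ≡-Reasoning
    f : ℕ → ℕ
    f j = iverson (j ≡ᵇ k)

module PowerSeries where

  open import Data.Nat as ℕ using (_∸_; _≡ᵇ_; _≤ᵇ_; _<?_)
  open import Data.Integer using (ℤ; +_; -_; _+_; _*_)
  open import Data.Integer.Properties
    using (+-identityˡ; +-identityʳ; +-inverseʳ; +-commutativeSemigroup; neg-distrib-+; *-distribˡ-+; neg-distribʳ-*;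
           *-zeroʳ; *-identityʳ)
  open import Data.Integer.Tactic.RingSolver using (solve-∀)
  import Data.Nat.Properties as ℕP
  open import Data.List using (foldr)
  open import Data.List.Properties using (map-applyUpTo)
  open import Data.List.Membership.Propositional.Properties using (∈-upTo⁺)
  open import Data.List.Relation.Unary.All using (All; []; _∷_; lookup)
  open import Relation.Nullary using (yes; no)
  open DegreeRecurrence using (≤ᵇ-suc; dShifted; d-recurrence)

  sumℤ : List ℕ → (ℕ → ℤ) → ℤ
  sumℤ l f = foldr _+_ (+ 0) (map f l)

  sumℤ-+ : ∀ l (f g : ℕ → ℤ) → sumℤ l (λ i → f i + g i) ≡ sumℤ l f + sumℤ l g
  sumℤ-+ []      f g = refl
  sumℤ-+ (i ∷ l) f g = trans (cong (λ z → (f i + g i) + z) (sumℤ-+ l f g))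
                             (interchange +-commutativeSemigroup (f i) (g i) _ _)

  sumℤ-neg : ∀ l (f : ℕ → ℤ) → sumℤ l (λ i → - f i) ≡ - sumℤ l f
  sumℤ-neg []      f = refl
  sumℤ-neg (i ∷ l) f = trans (cong (λ z → - f i + z) (sumℤ-neg l f)) (sym (neg-distrib-+ (f i) _))

  sumℤ-cong : ∀ l {f g : ℕ → ℤ} → (∀ i → f i ≡ g i) → sumℤ l f ≡ sumℤ l g
  sumℤ-cong []      f≡g = refl
  sumℤ-cong (i ∷ l) f≡g = cong₂ _+_ (f≡g i) (sumℤ-cong l f≡g)

  sumℤ-zero : ∀ l → sumℤ l (λ _ → + 0) ≡ + 0
  sumℤ-zero []      = refl
  sumℤ-zero (i ∷ l) = trans (+-identityˡ _) (sumℤ-zero l)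

  sumTo-suc : ∀ n (f : ℕ → ℤ) → sumTo (suc n) f ≡ f 0 + sumTo n (f ∘ suc)
  sumTo-suc n f = cong (λ l → f 0 + foldr _+_ (+ 0) l)
    (trans (map-applyUpTo suc f (suc n)) (sym (map-applyUpTo id (f ∘ suc) (suc n))))

  sumTo-at : ∀ n b (g : ℕ → ℤ) →
    sumTo n (λ i → if (n ∸ i) ≡ᵇ b then g i else + 0) ≡ (if b ≤ᵇ n then g (n ∸ b) else + 0)
  sumTo-at zero    zero    g = +-identityʳ (g 0)
  sumTo-at zero    (suc b) g = refl
  sumTo-at (suc n) b       g = trans (sumTo-suc n (λ i → if (suc n ∸ i) ≡ᵇ b then g i else + 0))
    (trans (cong (λ z → (if suc n ≡ᵇ b then g 0 else + 0) + z) (sumTo-at n b (g ∘ suc)))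
           (first-or-rest n b))
    where
    first-or-rest : ∀ n b → (if suc n ≡ᵇ b then g 0 else + 0) + (if b ≤ᵇ n then g (suc (n ∸ b)) else + 0)
                              ≡ (if b ≤ᵇ suc n then g (suc n ∸ b) else + 0)
    first-or-rest n             zero          = +-identityˡ (g (suc n))
    first-or-rest zero          (suc zero)    = +-identityʳ (g 0)
    first-or-rest zero          (suc (suc b)) = refl
    first-or-rest (suc n)       (suc b)       rewrite ≤ᵇ-suc b n | ≤ᵇ-suc b (suc n) = first-or-rest n b

  ⊗-congʳ : ∀ f {g g′ : Series} → (∀ n k → g n k ≡ g′ n k) → ∀ n k → (f ⊗ g) n k ≡ (f ⊗ g′) n k
  ⊗-congʳ f g≡g′ n k = sumℤ-cong (upTo (suc n)) λ i →
    sumℤ-cong (upTo (suc k)) λ j → cong (f i j *_) (g≡g′ (n ∸ i) (k ∸ j))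

  ⊗-⊕ʳ : ∀ f g h n k → (f ⊗ (g ⊕ h)) n k ≡ (f ⊗ g) n k + (f ⊗ h) n k
  ⊗-⊕ʳ f g h n k = trans
    (sumℤ-cong (upTo (suc n)) λ i → trans
      (sumℤ-cong (upTo (suc k)) λ j → *-distribˡ-+ (f i j) (g (n ∸ i) (k ∸ j)) (h (n ∸ i) (k ∸ j)))
      (sumℤ-+ (upTo (suc k)) (λ j → f i j * g (n ∸ i) (k ∸ j)) (λ j → f i j * h (n ∸ i) (k ∸ j))))
    (sumℤ-+ (upTo (suc n)) (λ i → sumTo k (λ j → f i j * g (n ∸ i) (k ∸ j)))
                           (λ i → sumTo k (λ j → f i j * h (n ∸ i) (k ∸ j))))

  ⊗-⊝ʳ : ∀ f g n k → (f ⊗ (⊝ g)) n k ≡ - (f ⊗ g) n k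
  ⊗-⊝ʳ f g n k = trans
    (sumℤ-cong (upTo (suc n)) λ i → trans
      (sumℤ-cong (upTo (suc k)) λ j → sym (neg-distribʳ-* (f i j) (g (n ∸ i) (k ∸ j))))
      (sumℤ-neg (upTo (suc k)) (λ j → f i j * g (n ∸ i) (k ∸ j))))
    (sumℤ-neg (upTo (suc n)) (λ i → sumTo k (λ j → f i j * g (n ∸ i) (k ∸ j))))

  -- Coefficient of x^k y^n in f · x^a y^b.
  shift : Series → ℕ → ℕ → Series
  shift f a b n k = if b ≤ᵇ n then (if a ≤ᵇ k then f (n ∸ b) (k ∸ a) else + 0) else + 0

  ⊗-mono : ∀ f a b n k → (f ⊗ mono a b) n k ≡ shift f a b n k
  ⊗-mono f a b n k = trans
    (sumℤ-cong (upTo (suc n)) λ i → inner i (n ∸ i ≡ᵇ b))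
    (sumTo-at n b (λ i → if a ≤ᵇ k then f i (k ∸ a) else + 0))
    where
    times-if : ∀ x c → x * (if c then + 1 else + 0) ≡ (if c then x else + 0)
    times-if x true  = *-identityʳ x
    times-if x false = *-zeroʳ x
    inner : ∀ i c → sumTo k (λ j → f i j * (if c ∧ (k ∸ j ≡ᵇ a) then + 1 else + 0))
                      ≡ (if c then (if a ≤ᵇ k then f i (k ∸ a) else + 0) else + 0)
    inner i true  = trans (sumℤ-cong (upTo (suc k)) λ j → times-if (f i j) (k ∸ j ≡ᵇ a)) (sumTo-at k a (f i))
    inner i false = trans (sumℤ-cong (upTo (suc k)) λ j → *-zeroʳ (f i j)) (sumℤ-zero (upTo (suc k)))

  denom-monomials : Series
  denom-monomials = (((one ⊕ (⊝ mono 1 1)) ⊕ (⊝ mono 1 2)) ⊕ mono 2 3) ⊕ (⊝ mono 1 3)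

  denom≡monomials : ∀ n k → denom n k ≡ denom-monomials n k
  denom≡monomials n k = trans
    (cong (λ z → z + - mono 1 3 n k)
          (trans (⊗-⊕ʳ P one (⊝ mono 1 2) n k)
                 (cong₂ _+_ (⊗-mono P 0 0 n k) (trans (⊗-⊝ʳ P (mono 1 2) n k) (cong -_ (⊗-mono P 1 2 n k))))))
    (table n k)
    where
    P = one ⊕ (⊝ mono 1 1)
    table : ∀ n k → shift P 0 0 n k + - shift P 1 2 n k + - mono 1 3 n k ≡ denom-monomials n k
    table 0 0 = refl
    table 0 1 = refl
    table 0 2 = refl
    table 0 (suc (suc (suc k))) = refl
    table 1 0 = refl
    table 1 1 = refl
    table 1 2 = refl
    table 1 (suc (suc (suc k))) = refl
    table 2 0 = refl
    table 2 1 = refl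
    table 2 2 = refl
    table 2 (suc (suc (suc k))) = refl
    table 3 0 = refl
    table 3 1 = refl
    table 3 2 = refl
    table 3 (suc (suc (suc k))) = refl
    table (suc (suc (suc (suc n)))) 0 = refl
    table (suc (suc (suc (suc n)))) 1 = refl
    table (suc (suc (suc (suc n)))) 2 = refl
    table (suc (suc (suc (suc n)))) (suc (suc (suc k))) = refl

  H : Series
  H = ((genD ⊕ y) ⊕ (⊝ mono 1 1)) ⊕ (⊝ mono 2 2)

  H⊗denom : Series
  H⊗denom n k = shift H 0 0 n k + - shift H 1 1 n k + - shift H 1 2 n k + shift H 2 3 n k + - shift H 1 3 n k

  H⊗denom-monomials : ∀ n k → (H ⊗ denom-monomials) n k ≡ H⊗denom n k
  H⊗denom-monomials n k = trans (⊗-⊕ʳ H X₄ (⊝ mono 1 3) n k) (cong₂ _+_ four-terms (minus-shift 1 3))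
    where
    X₂ X₃ X₄ : Series
    X₂ = one ⊕ (⊝ mono 1 1)
    X₃ = X₂ ⊕ (⊝ mono 1 2)
    X₄ = X₃ ⊕ mono 2 3
    minus-shift : ∀ a b → (H ⊗ (⊝ mono a b)) n k ≡ - shift H a b n k
    minus-shift a b = trans (⊗-⊝ʳ H (mono a b) n k) (cong -_ (⊗-mono H a b n k))
    two-terms : (H ⊗ X₂) n k ≡ shift H 0 0 n k + - shift H 1 1 n k
    two-terms = trans (⊗-⊕ʳ H one (⊝ mono 1 1) n k) (cong₂ _+_ (⊗-mono H 0 0 n k) (minus-shift 1 1))
    three-terms : (H ⊗ X₃) n k ≡ shift H 0 0 n k + - shift H 1 1 n k + - shift H 1 2 n k
    three-terms = trans (⊗-⊕ʳ H X₂ (⊝ mono 1 2) n k) (cong₂ _+_ two-terms (minus-shift 1 2))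
    four-terms : (H ⊗ X₄) n k ≡ shift H 0 0 n k + - shift H 1 1 n k + - shift H 1 2 n k + shift H 2 3 n k
    four-terms = trans (⊗-⊕ʳ H X₃ (mono 2 3) n k) (cong₂ _+_ three-terms (⊗-mono H 2 3 n k))

  H-shift : ∀ m a k → (if a ≤ᵇ k then H (3 ℕ.+ m) (k ∸ a) else + 0) ≡ + dShifted a (3 ℕ.+ m) k
  H-shift m a k with a ≤ᵇ k
  ... | true  = cong +_ (trans (ℕP.+-identityʳ _) (trans (ℕP.+-identityʳ _) (ℕP.+-identityʳ _)))
  ... | false = refl

  cancel : ∀ x y z v w → x ℕ.+ v ≡ y ℕ.+ z ℕ.+ w → + x + - + y + - + z + + v + - + w ≡ + 0
  cancel x y z v w x+v≡y+z+w = begin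
    + x + - + y + - + z + + v + - + w   ≡⟨ regroup (+ x) (+ y) (+ z) (+ v) (+ w) ⟩
    + (x ℕ.+ v) + - + (y ℕ.+ z ℕ.+ w)   ≡⟨ cong (λ t → + t + - + (y ℕ.+ z ℕ.+ w)) x+v≡y+z+w ⟩
    + (y ℕ.+ z ℕ.+ w) + - + (y ℕ.+ z ℕ.+ w) ≡⟨ +-inverseʳ (+ (y ℕ.+ z ℕ.+ w)) ⟩
    + 0                                 ∎
    where
    open ≡-Reasoning
    regroup : ∀ x y z v w → x + - y + - z + v + - w ≡ (x + v) + - ((y + z) + w)
    regroup = solve-∀

  H⊗denom≡numer-from-7 : ∀ m k → H⊗denom (7 ℕ.+ m) k ≡ numer (7 ℕ.+ m) k
  H⊗denom≡numer-from-7 m k = begin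
    H⊗denom (7 ℕ.+ m) k
      ≡⟨ cong₂ _+_ (cong₂ _+_ (cong₂ _+_ (cong₂ _+_ (H-shift (4 ℕ.+ m) 0 k)
                                                    (cong -_ (H-shift (3 ℕ.+ m) 1 k)))
                                         (cong -_ (H-shift (2 ℕ.+ m) 1 k)))
                              (H-shift (1 ℕ.+ m) 2 k))
                   (cong -_ (H-shift (1 ℕ.+ m) 1 k)) ⟩
    + dShifted 0 (7 ℕ.+ m) k + - + dShifted 1 (6 ℕ.+ m) k + - + dShifted 1 (5 ℕ.+ m) k
      + + dShifted 2 (4 ℕ.+ m) k + - + dShifted 1 (4 ℕ.+ m) k
      ≡⟨ cancel (dShifted 0 (7 ℕ.+ m) k) (dShifted 1 (6 ℕ.+ m) k) (dShifted 1 (5 ℕ.+ m) k)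
                (dShifted 2 (4 ℕ.+ m) k) (dShifted 1 (4 ℕ.+ m) k) (d-recurrence m k) ⟩
    + 0
      ∎
    where open ≡-Reasoning

  -- For k ≥ 9 every entry vanishes, as Φ_n has no vertex of degree above n.
  H⊗denom≡numer-below-7 : ∀ k → All (λ n → H⊗denom n k ≡ numer n k) (upTo 7)
  H⊗denom≡numer-below-7 0 = refl ∷ refl ∷ refl ∷ refl ∷ refl ∷ refl ∷ refl ∷ []
  H⊗denom≡numer-below-7 1 = refl ∷ refl ∷ refl ∷ refl ∷ refl ∷ refl ∷ refl ∷ []
  H⊗denom≡numer-below-7 2 = refl ∷ refl ∷ refl ∷ refl ∷ refl ∷ refl ∷ refl ∷ []
  H⊗denom≡numer-below-7 3 = refl ∷ refl ∷ refl ∷ refl ∷ refl ∷ refl ∷ refl ∷ []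
  H⊗denom≡numer-below-7 4 = refl ∷ refl ∷ refl ∷ refl ∷ refl ∷ refl ∷ refl ∷ []
  H⊗denom≡numer-below-7 5 = refl ∷ refl ∷ refl ∷ refl ∷ refl ∷ refl ∷ refl ∷ []
  H⊗denom≡numer-below-7 6 = refl ∷ refl ∷ refl ∷ refl ∷ refl ∷ refl ∷ refl ∷ []
  H⊗denom≡numer-below-7 7 = refl ∷ refl ∷ refl ∷ refl ∷ refl ∷ refl ∷ refl ∷ []
  H⊗denom≡numer-below-7 8 = refl ∷ refl ∷ refl ∷ refl ∷ refl ∷ refl ∷ refl ∷ []
  H⊗denom≡numer-below-7 (suc (suc (suc (suc (suc (suc (suc (suc (suc k))))))))) =
    refl ∷ refl ∷ refl ∷ refl ∷ refl ∷ refl ∷ refl ∷ []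

  H⊗denom≡numer : ∀ n k → H⊗denom n k ≡ numer n k
  H⊗denom≡numer n k with n <? 7
  ... | yes n<7 = lookup (H⊗denom≡numer-below-7 k) (∈-upTo⁺ n<7)
  ... | no  n≮7 = subst (λ n → H⊗denom n k ≡ numer n k) (ℕP.m+[n∸m]≡n (ℕP.≮⇒≥ n≮7))
                        (H⊗denom≡numer-from-7 (n ∸ 7) k)

theorem6 : ∀ (n k : ℕ) →
    ((((genD ⊕ y) ⊕ (⊝ mono 1 1)) ⊕ (⊝ mono 2 2)) ⊗ denom) n k ≡ numer n k
theorem6 n k = trans (⊗-congʳ H denom≡monomials n k) (trans (H⊗denom-monomials n k) (H⊗denom≡numer n k))
  where open PowerSeries
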